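{- Let $k$ and $n$ be integers with $\frac{3k}{2}\leq n\leq 3k$. Let $\mathcal F$ be a $k$-uniform family of subsets of $[n]=\{1,\ldots,n\}$ (i.e. $|F|=k$ for every $F\in\mathcal F$) which contains no sunflower with $3$ petals. Then $$|\mathcal F|\leq 3\binom{n}{n/3}.$$
   Context: A family $\{F_1,\ldots,F_t\}$ of $t$ distinct subsets of $[n]$ is a sunflower with $t$ petals if $F_i\cap F_j=\bigcap_{s=1}^t F_s$ for all $1\leq i< j\leq t$. A family contains no sunflower with $3$ petals if no three distinct members of it form a sunflower with $3$ petals. -}

module Defs where

open import Data.Nat using (ℕ)
open import Data.Fin.Subset using (Subset; _∩_)
open import Data.List using (List)
open import Data.List.Membership.Propositional using (_∈_)
open import Data.Product using (_×_)
open import Relation.Binary.PropositionalEquality using (_≡_; _≢_)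
open import Relation.Nullary using (¬_)

IsSunflower3 : {n : ℕ} → Subset n → Subset n → Subset n → Set
IsSunflower3 A B C =
  A ≢ B × A ≢ C × B ≢ C ×
  (A ∩ B ≡ A ∩ B ∩ C) × (A ∩ C ≡ A ∩ B ∩ C) × (B ∩ C ≡ A ∩ B ∩ C)

NoSunflower3 : {n : ℕ} → List (Subset n) → Set
NoSunflower3 𝓕 = ∀ A B C → A ∈ 𝓕 → B ∈ 𝓕 → C ∈ 𝓕 → ¬ IsSunflower3 A B C

module Submission where

-- A k-uniform sunflower-free family of N subsets of [n] with n ≤ 3k has N ≤ 3·C(n, ⌊n/3⌋), by the
-- slice-rank method over ℤ, with sets viewed as 0/1 points.
-- * Linear algebra: Gaussian elimination gives, for a support D and r functionals, ≥ |D| - r pivots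
--   carrying vectors on D orthogonal to the functionals (PivotBasis).  Three nested eliminations give
--   diagonal-bound: if a diagonal tensor with nonzero diagonal has trilinear form vanishing on
--   arguments orthogonal to W₁, W₂, W₃, then N ≤ |W₁| + |W₂| + |W₃|.
-- * The polynomial Φ(X,Y,Z) = ∏ₓ (Xₓ + Yₓ + Zₓ - 2) of degree n: its trilinear form on points Fᵢ
--   vanishes on arguments orthogonal to all monomials of degrees < a, < b, < c when n < a + b + c
--   (Φ-vanishing).  On a k-uniform family, orthogonality to the C(n, d) monomials of degree exactly
--   d ≤ k already gives orthogonality in every degree ≤ d (orthAt⇒orthBelow); take d = ⌊n/3⌋.
-- * Φ(X,Y,Z) ≠ 0 says no point lies in exactly two of X, Y, Z, i.e. the petal equations of a
--   sunflower; on a uniform sunflower-free family this forces X = Y = Z (Φ-nonzero⇒equal).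
-- sunflower-free-bound combines the three parts; theorem5 specialises it to lists.

module SliceRank where

  open import Data.Nat as ℕ using (ℕ; zero; suc; z≤n; s≤s; _≤_; _<_; pred)
  import Data.Nat.Properties as ℕP
  open import Data.Nat.Combinatorics using (_C_; nCk+nC[k+1]≡[n+1]C[k+1])
  open import Data.Integer using (ℤ; +_; 0ℤ; 1ℤ; _+_; _*_; _-_; -_)
  import Data.Integer.Properties as ℤP
  open import Data.Integer.Tactic.RingSolver using (solve-∀)
  open import Algebra.Properties.Semiring.Sum ℤP.+-*-semiring
    using (sum; sum-cong-≗; sum-replicate-zero; sum-remove; ∑-distrib-+; *-distribˡ-sum; *-distribʳ-sum)
  open import Data.Bool using (Bool; true; false; _∧_; if_then_else_)
  import Data.Bool.Properties as BoolP
  open import Data.Fin using (Fin; zero; suc; punchIn)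
  open import Data.Fin.Properties using (any?; punchInᵢ≢i) renaming (_≟_ to _≟ᶠ_)
  open import Data.Vec using ([]; _∷_; head; tail; here; there)
  open import Data.Vec.Properties using (≡-dec)
  open import Data.Vec.Functional using (Vector)
  open import Data.Fin.Subset
    using (Subset; inside; outside; _∈_; _∉_; _⊆_; _∩_; ∣_∣)
    renaming (⊤ to Full; ⊥ to ∅; _-_ to _∖_)
  open import Data.Fin.Subset.Properties
    using (_∈?_; nonempty?; Empty-unique; ∣⊥∣≡0; ∣⊤∣≡n; p─q⊆p; p─⊥≡p; p∩q⊆p; p∩q⊆q; x∈p∩q⁺;
           drop-∷-⊆; p⊆q⇒∣p∣≤∣q∣)
  open import Data.List using (List; []; _∷_; _++_; length; map; lookup)
  import Data.List.Properties as ListP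
  open import Data.List.Relation.Unary.All as All using (All; []; _∷_)
  open import Data.List.Relation.Unary.All.Properties using (map⁺; map⁻)
  open import Data.List.Relation.Unary.Any using (here)
  open import Data.List.Relation.Unary.AllPairs using (_∷_)
  open import Data.List.Relation.Unary.Unique.Propositional using (Unique)
  open import Data.List.Membership.Propositional using () renaming (_∈_ to _∈ₗ_)
  open import Data.List.Membership.Propositional.Properties using (∈-map⁺; ∈-++⁺ˡ; ∈-++⁺ʳ; ∈-lookup)
  open import Data.Product using (_×_; _,_)
  open import Data.Sum using (inj₁; inj₂)
  open import Function using (_∘_)
  open import Relation.Nullary using (¬_; Dec; yes; no; does; contradiction)
  open import Relation.Nullary.Decidable using (_×-dec_; ¬?; dec-true; dec-false; decidable-stable)
  open import Relation.Binary.PropositionalEquality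
  open import Defs using (IsSunflower3)

  nonzero-product : ∀ {a b : ℤ} → a ≢ 0ℤ → b ≢ 0ℤ → a * b ≢ 0ℤ
  nonzero-product {a} a≢0 b≢0 ab≡0 with ℤP.i*j≡0⇒i≡0∨j≡0 a ab≡0
  ... | inj₁ a≡0 = a≢0 a≡0
  ... | inj₂ b≡0 = b≢0 b≡0

  nonzero-factorˡ : ∀ a b → a * b ≢ 0ℤ → a ≢ 0ℤ
  nonzero-factorˡ a b ab≢0 a≡0 = ab≢0 (trans (cong (_* b) a≡0) (ℤP.*-zeroˡ b))

  nonzero-factorʳ : ∀ a b → a * b ≢ 0ℤ → b ≢ 0ℤ
  nonzero-factorʳ a b ab≢0 b≡0 = ab≢0 (trans (cong (a *_) b≡0) (ℤP.*-zeroʳ a))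

  sum-zero : ∀ {N} (f : Vector ℤ N) → (∀ i → f i ≡ 0ℤ) → sum f ≡ 0ℤ
  sum-zero {N} f f≡0 = trans (sum-cong-≗ f≡0) (sum-replicate-zero N)

  sum-single : ∀ {N} (f : Vector ℤ N) p → (∀ i → i ≢ p → f i ≡ 0ℤ) → sum f ≡ f p
  sum-single {suc N} f p off-p = begin
    sum f                      ≡⟨ sum-remove {i = p} f ⟩
    f p + sum (f ∘ punchIn p)  ≡⟨ cong (_+_ (f p)) (sum-zero _ (λ i → off-p _ (punchInᵢ≢i p i))) ⟩
    f p + 0ℤ                   ≡⟨ ℤP.+-identityʳ (f p) ⟩
    f p                        ∎
    where open ≡-Reasoning

  ∑³ : ∀ {N} → (Fin N → Fin N → Fin N → ℤ) → ℤ
  ∑³ f = sum λ i → sum λ j → sum λ l → f i j l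

  trilinear : ∀ {N} → (Fin N → Fin N → Fin N → ℤ) → (h u v : Vector ℤ N) → ℤ
  trilinear T h u v = ∑³ λ i j l → h i * (u j * (v l * T i j l))

  ∑³-cong : ∀ {N} {f g : Fin N → Fin N → Fin N → ℤ} → (∀ i j l → f i j l ≡ g i j l) → ∑³ f ≡ ∑³ g
  ∑³-cong f≡g = sum-cong-≗ λ i → sum-cong-≗ λ j → sum-cong-≗ λ l → f≡g i j l

  ∑³-+ : ∀ {N} (f g : Fin N → Fin N → Fin N → ℤ) → ∑³ (λ i j l → f i j l + g i j l) ≡ ∑³ f + ∑³ g
  ∑³-+ f g = begin
    ∑³ (λ i j l → f i j l + g i j l)
      ≡⟨ sum-cong-≗ (λ i → sum-cong-≗ λ j → ∑-distrib-+ (f i j) (g i j)) ⟩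
    sum (λ i → sum (λ j → sum (f i j) + sum (g i j)))
      ≡⟨ sum-cong-≗ (λ i → ∑-distrib-+ (λ j → sum (f i j)) (λ j → sum (g i j))) ⟩
    sum (λ i → sum (λ j → sum (f i j)) + sum (λ j → sum (g i j)))
      ≡⟨ ∑-distrib-+ (λ i → sum (λ j → sum (f i j))) (λ i → sum (λ j → sum (g i j))) ⟩
    ∑³ f + ∑³ g ∎
    where open ≡-Reasoning

  ∑³-scale : ∀ {N} c (f : Fin N → Fin N → Fin N → ℤ) → ∑³ (λ i j l → c * f i j l) ≡ c * ∑³ f
  ∑³-scale c f = sym (begin
    c * ∑³ f
      ≡⟨ *-distribˡ-sum c (λ i → sum (λ j → sum (f i j))) ⟩
    sum (λ i → c * sum (λ j → sum (f i j)))
      ≡⟨ sum-cong-≗ (λ i → *-distribˡ-sum c (λ j → sum (f i j))) ⟩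
    sum (λ i → sum (λ j → c * sum (f i j)))
      ≡⟨ sum-cong-≗ (λ i → sum-cong-≗ λ j → *-distribˡ-sum c (f i j)) ⟩
    ∑³ (λ i j l → c * f i j l) ∎)
    where open ≡-Reasoning

  ∑³-product : ∀ {N} (h u v : Vector ℤ N) → ∑³ (λ i j l → h i * (u j * v l)) ≡ sum h * (sum u * sum v)
  ∑³-product h u v = sym (begin
    sum h * (sum u * sum v)
      ≡⟨ *-distribʳ-sum (sum u * sum v) h ⟩
    sum (λ i → h i * (sum u * sum v))
      ≡⟨ sum-cong-≗ (λ i → cong (h i *_) (*-distribʳ-sum (sum v) u)) ⟩
    sum (λ i → h i * sum (λ j → u j * sum v))
      ≡⟨ sum-cong-≗ (λ i → *-distribˡ-sum (h i) (λ j → u j * sum v)) ⟩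
    sum (λ i → sum (λ j → h i * (u j * sum v)))
      ≡⟨ sum-cong-≗ (λ i → sum-cong-≗ λ j → cong (h i *_) (*-distribˡ-sum (u j) v)) ⟩
    sum (λ i → sum (λ j → h i * sum (λ l → u j * v l)))
      ≡⟨ sum-cong-≗ (λ i → sum-cong-≗ λ j → *-distribˡ-sum (h i) (λ l → u j * v l)) ⟩
    ∑³ (λ i j l → h i * (u j * v l)) ∎)
    where open ≡-Reasoning

  ∑³-concentrated : ∀ {N} (f : Fin N → Fin N → Fin N → ℤ) {p} →
    (∀ i j l → f i j l ≢ 0ℤ → i ≡ p × j ≡ p × l ≡ p) → ∑³ f ≡ f p p p
  ∑³-concentrated f {p} support = begin
    ∑³ f                         ≡⟨ sum-single _ p (λ i i≢p → sum-zero _ λ j → sum-zero _ λ l →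
                                      off-p i j l (λ { (i≡p , _) → i≢p i≡p })) ⟩
    sum (λ j → sum (f p j))      ≡⟨ sum-single _ p (λ j j≢p → sum-zero _ λ l →
                                      off-p p j l (λ { (_ , j≡p , _) → j≢p j≡p })) ⟩
    sum (f p p)                  ≡⟨ sum-single _ p (λ l l≢p →
                                      off-p p p l (λ { (_ , _ , l≡p) → l≢p l≡p })) ⟩
    f p p p                      ∎
    where
    open ≡-Reasoning
    off-p : ∀ i j l → ¬ (i ≡ p × j ≡ p × l ≡ p) → f i j l ≡ 0ℤ
    off-p i j l off = decidable-stable (f i j l ℤP.≟ 0ℤ) (λ nz → off (support i j l nz))

  trilinear-collapse : ∀ {N} (T : Fin N → Fin N → Fin N → ℤ) (h u v : Vector ℤ N) {p} →
    (∀ i j l → T i j l ≢ 0ℤ → i ≡ j × j ≡ l) → (∀ i → i ≢ p → h i * u i ≡ 0ℤ) →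
    trilinear T h u v ≡ h p * (u p * (v p * T p p p))
  trilinear-collapse T h u v {p} diagonal disjoint = ∑³-concentrated _ support
    where
    open ≡-Reasoning
    support : ∀ i j l → h i * (u j * (v l * T i j l)) ≢ 0ℤ → i ≡ p × j ≡ p × l ≡ p
    support i j l nz with diagonal i j l (nonzero-factorʳ (v l) _ (nonzero-factorʳ (u j) _
                                           (nonzero-factorʳ (h i) _ nz)))
    ... | refl , refl with i ≟ᶠ p
    ...   | yes i≡p = i≡p , i≡p , i≡p
    ...   | no i≢p = contradiction (begin
      h i * (u i * (v i * T i i i))  ≡⟨ ℤP.*-assoc (h i) (u i) _ ⟨
      h i * u i * (v i * T i i i)    ≡⟨ cong (_* (v i * T i i i)) (disjoint i i≢p) ⟩
      0ℤ * (v i * T i i i)          ≡⟨ ℤP.*-zeroˡ (v i * T i i i) ⟩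
      0ℤ                             ∎) nz

  _·_ : ∀ {N} → Vector ℤ N → Vector ℤ N → ℤ
  s · e = sum λ i → s i * e i

  Orthogonal : ∀ {N} → Vector ℤ N → Vector ℤ N → Set
  Orthogonal s e = s · e ≡ 0ℤ

  private
    expand-combination : ∀ a b x y z → (a * x - b * y) * z ≡ a * (x * z) + (- b) * (y * z)
    expand-combination = solve-∀
    collect-combination : ∀ a b x y → a * x + (- b) * y ≡ a * x - b * y
    collect-combination = solve-∀
    cross-cancel : ∀ a b → a * b - b * a ≡ 0ℤ
    cross-cancel = solve-∀
    combination-of-zeros : ∀ a b → a * 0ℤ - b * 0ℤ ≡ 0ℤ
    combination-of-zeros = solve-∀
    drop-zero-term : ∀ a b x → a * x - b * 0ℤ ≡ a * x
    drop-zero-term = solve-∀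

  ·-combination : ∀ {N} a b (f g e : Vector ℤ N) →
    (λ i → a * f i - b * g i) · e ≡ a * (f · e) - b * (g · e)
  ·-combination a b f g e = begin
    sum (λ i → (a * f i - b * g i) * e i)
      ≡⟨ sum-cong-≗ (λ i → expand-combination a b (f i) (g i) (e i)) ⟩
    sum (λ i → a * (f i * e i) + (- b) * (g i * e i))
      ≡⟨ ∑-distrib-+ (λ i → a * (f i * e i)) (λ i → (- b) * (g i * e i)) ⟩
    sum (λ i → a * (f i * e i)) + sum (λ i → (- b) * (g i * e i))
      ≡⟨ cong₂ _+_ (*-distribˡ-sum a (λ i → f i * e i)) (*-distribˡ-sum (- b) (λ i → g i * e i)) ⟨
    a * (f · e) + (- b) * (g · e)
      ≡⟨ collect-combination a b (f · e) (g · e) ⟩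
    a * (f · e) - b * (g · e) ∎
    where open ≡-Reasoning

  combination-orthogonal : ∀ {N} a b {f g e : Vector ℤ N} →
    Orthogonal f e → Orthogonal g e → Orthogonal (λ i → a * f i - b * g i) e
  combination-orthogonal a b {f} {g} {e} f⊥e g⊥e =
    trans (·-combination a b f g e)
          (trans (cong₂ (λ x y → a * x - b * y) f⊥e g⊥e) (combination-of-zeros a b))

  -- Gaussian elimination.

  ∣p∣≤1+∣p-x∣ : ∀ {n} (p : Subset n) x → ∣ p ∣ ≤ suc ∣ p ∖ x ∣
  ∣p∣≤1+∣p-x∣ (inside ∷ p)  zero    = ℕP.≤-reflexive (cong (suc ∘ ∣_∣) (sym (p─⊥≡p p)))
  ∣p∣≤1+∣p-x∣ (outside ∷ p) zero    =
    ℕP.≤-trans (ℕP.n≤1+n _) (ℕP.≤-reflexive (cong (suc ∘ ∣_∣) (sym (p─⊥≡p p))))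
  ∣p∣≤1+∣p-x∣ (inside ∷ p)  (suc x) = s≤s (∣p∣≤1+∣p-x∣ p x)
  ∣p∣≤1+∣p-x∣ (outside ∷ p) (suc x) = ∣p∣≤1+∣p-x∣ p x

  x∉p-x : ∀ {n} (p : Subset n) x → x ∉ p ∖ x
  x∉p-x (_ ∷ p) zero    ()
  x∉p-x (_ ∷ p) (suc x) (there x∈p-x) = x∉p-x p x x∈p-x

  δ : ∀ {N} → Fin N → Vector ℤ N
  δ p x = if does (p ≟ᶠ x) then 1ℤ else 0ℤ

  record PivotBasis {N : ℕ} (D : Subset N) (W : List (Vector ℤ N)) : Set where
    field
      pivots     : Subset N
      pivots⊆D   : pivots ⊆ D
      size       : ∣ D ∣ ≤ ∣ pivots ∣ ℕ.+ length W
      vec        : Fin N → Vector ℤ N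
      diagonal   : ∀ {p} → p ∈ pivots → vec p p ≢ 0ℤ
      offDiag    : ∀ {p q} → p ∈ pivots → q ∈ pivots → p ≢ q → vec p q ≡ 0ℤ
      support    : ∀ {p x} → p ∈ pivots → x ∉ D → vec p x ≡ 0ℤ
      orthogonal : ∀ {p} → p ∈ pivots → All (Orthogonal (vec p)) W

  pivotBasis-[] : ∀ {N} (D : Subset N) → PivotBasis D []
  pivotBasis-[] D = record
    { pivots = D ; pivots⊆D = λ x∈D → x∈D ; size = ℕP.m≤m+n _ 0 ; vec = δ
    ; diagonal = λ {p} _ δpp≡0 → contradiction (trans (sym (δ-at p p refl)) δpp≡0) λ ()
    ; offDiag = λ {p} {q} _ _ p≢q → δ-off p q p≢q
    ; support = λ {p} {x} p∈D x∉D → δ-off p x (λ { refl → x∉D p∈D })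
    ; orthogonal = λ _ → [] }
    where
    δ-at : ∀ {N} (p x : Fin N) → p ≡ x → δ p x ≡ 1ℤ
    δ-at p x p≡x = cong (if_then 1ℤ else 0ℤ) (dec-true (p ≟ᶠ x) p≡x)
    δ-off : ∀ {N} (p x : Fin N) → p ≢ x → δ p x ≡ 0ℤ
    δ-off p x p≢x = cong (if_then 1ℤ else 0ℤ) (dec-false (p ≟ᶠ x) p≢x)

  pivotBasis-keep : ∀ {N} {D : Subset N} {W} e (B : PivotBasis D W) →
    (∀ {p} → p ∈ PivotBasis.pivots B → Orthogonal (PivotBasis.vec B p) e) → PivotBasis D (e ∷ W)
  pivotBasis-keep e B e-orth = record
    { pivots = pivots ; pivots⊆D = pivots⊆D
    ; size = ℕP.≤-trans size (ℕP.+-monoʳ-≤ ∣ pivots ∣ (ℕP.n≤1+n _))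
    ; vec = vec ; diagonal = diagonal ; offDiag = offDiag ; support = support
    ; orthogonal = λ p∈ → e-orth p∈ ∷ orthogonal p∈ }
    where open PivotBasis B

  pivotBasis-eliminate : ∀ {N} {D : Subset N} {W} e (B : PivotBasis D W) {q} →
    q ∈ PivotBasis.pivots B → PivotBasis.vec B q · e ≢ 0ℤ → PivotBasis D (e ∷ W)
  pivotBasis-eliminate {N} {D} {W} e B {q} q∈ αq≢0 = record
    { pivots = pivots ∖ q
    ; pivots⊆D = λ p∈ → pivots⊆D (kept p∈)
    ; size = ℕP.≤-trans size (ℕP.≤-trans (ℕP.+-monoˡ-≤ (length W) (∣p∣≤1+∣p-x∣ pivots q))
                                         (ℕP.≤-reflexive (sym (ℕP.+-suc _ _))))
    ; vec = vec′
    ; diagonal = diagonal′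
    ; offDiag = λ {p} {p′} p∈ p′∈ p≢p′ → trans
        (cong₂ (λ x y → α q * x - α p * y) (offDiag (kept p∈) (kept p′∈) p≢p′)
                                           (offDiag q∈ (kept p′∈) (≢q p′∈ ∘ sym)))
        (combination-of-zeros (α q) (α p))
    ; support = λ {p} p∈ x∉D → trans
        (cong₂ (λ x y → α q * x - α p * y) (support (kept p∈) x∉D) (support q∈ x∉D))
        (combination-of-zeros (α q) (α p))
    ; orthogonal = λ {p} p∈ →
        trans (·-combination (α q) (α p) (vec p) (vec q) e) (cross-cancel (α q) (α p))
        ∷ All.zipWith (λ (p⊥ , q⊥) → combination-orthogonal (α q) (α p) {vec p} {vec q} p⊥ q⊥)
                      (orthogonal (kept p∈) , orthogonal q∈) }
    where
    open PivotBasis B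
    open ≡-Reasoning
    α : Fin N → ℤ
    α p = vec p · e
    vec′ : Fin N → Vector ℤ N
    vec′ p x = α q * vec p x - α p * vec q x
    kept : ∀ {p} → p ∈ pivots ∖ q → p ∈ pivots
    kept = p─q⊆p pivots _
    ≢q : ∀ {p} → p ∈ pivots ∖ q → p ≢ q
    ≢q p∈ refl = x∉p-x pivots q p∈
    diagonal′ : ∀ {p} → p ∈ pivots ∖ q → vec′ p p ≢ 0ℤ
    diagonal′ {p} p∈ vec′pp≡0 = nonzero-product αq≢0 (diagonal (kept p∈)) (begin
      α q * vec p p                 ≡⟨ drop-zero-term (α q) (α p) (vec p p) ⟨
      α q * vec p p - α p * 0ℤ      ≡⟨ cong (λ y → α q * vec p p - α p * y)
                                          (offDiag q∈ (kept p∈) (≢q p∈ ∘ sym)) ⟨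
      vec′ p p                      ≡⟨ vec′pp≡0 ⟩
      0ℤ                            ∎)

  pivotBasis : ∀ {N} (D : Subset N) W → PivotBasis D W
  pivotBasis D []      = pivotBasis-[] D
  pivotBasis D (e ∷ W) with any? (λ q → (q ∈? pivots) ×-dec ¬? ((vec q · e) ℤP.≟ 0ℤ))
    where open PivotBasis (pivotBasis D W)
  ... | yes (q , q∈ , αq≢0) = pivotBasis-eliminate e (pivotBasis D W) q∈ αq≢0
  ... | no none = pivotBasis-keep e (pivotBasis D W)
        (λ {p} p∈ → decidable-stable (_ ℤP.≟ 0ℤ) (λ αp≢0 → none (p , p∈ , αp≢0)))

  -- Run elimination three times, each time inside the pivots of the previous
  -- run.  A pivot p surviving all three runs would give vectors h, u, v (one from each run) whose
  -- trilinear form collapses to the nonzero term h p · u p · v p · T p p p; so no pivot survives.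
  diagonal-bound : ∀ {N} (T : Fin N → Fin N → Fin N → ℤ) (W₁ W₂ W₃ : List (Vector ℤ N)) →
    (∀ i j l → T i j l ≢ 0ℤ → i ≡ j × j ≡ l) →
    (∀ i → T i i i ≢ 0ℤ) →
    (∀ h u v → All (Orthogonal h) W₁ → All (Orthogonal u) W₂ → All (Orthogonal v) W₃ →
       trilinear T h u v ≡ 0ℤ) →
    N ≤ length W₁ ℕ.+ length W₂ ℕ.+ length W₃
  diagonal-bound {N} T W₁ W₂ W₃ diagonal nondegenerate vanishing = begin
    N                                         ≡⟨ ∣⊤∣≡n N ⟨
    ∣ Full {N} ∣                              ≤⟨ B₃.size ⟩
    ∣ B₃.pivots ∣ ℕ.+ r₃                      ≤⟨ ℕP.+-monoˡ-≤ r₃ B₂.size ⟩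
    ∣ B₂.pivots ∣ ℕ.+ r₂ ℕ.+ r₃               ≤⟨ ℕP.+-monoˡ-≤ r₃ (ℕP.+-monoˡ-≤ r₂ B₁.size) ⟩
    ∣ B₁.pivots ∣ ℕ.+ r₁ ℕ.+ r₂ ℕ.+ r₃        ≡⟨ cong (λ t → t ℕ.+ r₁ ℕ.+ r₂ ℕ.+ r₃) no-pivot-left ⟩
    r₁ ℕ.+ r₂ ℕ.+ r₃                          ∎
    where
    open ℕP.≤-Reasoning
    r₁ = length W₁
    r₂ = length W₂
    r₃ = length W₃
    B₃ = pivotBasis Full W₃
    module B₃ = PivotBasis B₃
    B₂ = pivotBasis B₃.pivots W₂
    module B₂ = PivotBasis B₂
    B₁ = pivotBasis B₂.pivots W₁
    module B₁ = PivotBasis B₁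

    no-common-pivot : ∀ {p} → p ∉ B₁.pivots
    no-common-pivot {p} p∈₁ = nonzero (trans (sym collapse)
        (vanishing h u v (B₁.orthogonal p∈₁) (B₂.orthogonal p∈₂) (B₃.orthogonal p∈₃)))
      where
      p∈₂ = B₁.pivots⊆D p∈₁
      p∈₃ = B₂.pivots⊆D p∈₂
      h = B₁.vec p
      u = B₂.vec p
      v = B₃.vec p
      -- h lives on the pivots of B₂, where u vanishes except at p.
      disjoint : ∀ i → i ≢ p → h i * u i ≡ 0ℤ
      disjoint i i≢p with i ∈? B₂.pivots
      ... | yes i∈₂ = trans (cong (h i *_) (B₂.offDiag p∈₂ i∈₂ (i≢p ∘ sym))) (ℤP.*-zeroʳ (h i))
      ... | no i∉₂  = trans (cong (_* u i) (B₁.support p∈₁ i∉₂)) (ℤP.*-zeroˡ (u i))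
      collapse : trilinear T h u v ≡ h p * (u p * (v p * T p p p))
      collapse = trilinear-collapse T h u v diagonal disjoint
      nonzero : h p * (u p * (v p * T p p p)) ≢ 0ℤ
      nonzero = nonzero-product (B₁.diagonal p∈₁) (nonzero-product (B₂.diagonal p∈₂)
                  (nonzero-product (B₃.diagonal p∈₃) (nondegenerate p)))

    no-pivot-left : ∣ B₁.pivots ∣ ≡ 0
    no-pivot-left with nonempty? B₁.pivots
    ... | yes (p , p∈₁) = contradiction p∈₁ no-common-pivot
    ... | no empty      = trans (cong ∣_∣ (Empty-unique empty)) (∣⊥∣≡0 N)

  -- The polynomial Φ(X, Y, Z) = ∏ₓ (Xₓ + Yₓ + Zₓ - 2) on 0/1 points, and monomials.

  χ : Bool → ℤ
  χ true  = 1ℤ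
  χ false = 0ℤ

  Φ : ∀ {n} → Subset n → Subset n → Subset n → ℤ
  Φ []      []      []      = 1ℤ
  Φ (x ∷ X) (y ∷ Y) (z ∷ Z) = (χ x + χ y + χ z - + 2) * Φ X Y Z

  Φ-empty : (X Y Z : Subset 0) → Φ X Y Z ≡ 1ℤ
  Φ-empty [] [] [] = refl

  Φ-head : ∀ {n} (X Y Z : Subset (suc n)) →
    Φ X Y Z ≡ (χ (head X) + χ (head Y) + χ (head Z) - + 2) * Φ (tail X) (tail Y) (tail Z)
  Φ-head (x ∷ X) (y ∷ Y) (z ∷ Z) = refl

  ΦOn : ∀ {N n} → (Fin N → Subset n) → Fin N → Fin N → Fin N → ℤ
  ΦOn F i j l = Φ (F i) (F j) (F l)

  -- monomial A X = ∏_{a ∈ A} Xₐ, the monomial with support A evaluated at the point X.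
  monomial : ∀ {n} → Subset n → Subset n → ℤ
  monomial []            []      = 1ℤ
  monomial (inside ∷ A)  (x ∷ X) = χ x * monomial A X
  monomial (outside ∷ A) (x ∷ X) = monomial A X

  monomial-∅ : ∀ {n} (X : Subset n) → monomial ∅ X ≡ 1ℤ
  monomial-∅ []      = refl
  monomial-∅ (x ∷ X) = monomial-∅ X

  monomial-inside : ∀ {n} (A : Subset n) X → monomial (inside ∷ A) X ≡ χ (head X) * monomial A (tail X)
  monomial-inside A (x ∷ X) = refl

  monomial-outside : ∀ {n} (A : Subset n) X → monomial (outside ∷ A) X ≡ monomial A (tail X)
  monomial-outside A (x ∷ X) = refl

  Annihilates : ∀ {N n} → (Fin N → Subset n) → Vector ℤ N → Subset n → Set
  Annihilates F h A = sum (λ i → h i * monomial A (F i)) ≡ 0ℤ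

  OrthBelow : ∀ {N n} → ℕ → (Fin N → Subset n) → Vector ℤ N → Set
  OrthBelow a F h = ∀ A → ∣ A ∣ < a → Annihilates F h A

  OrthAt : ∀ {N n} → ℕ → (Fin N → Subset n) → Vector ℤ N → Set
  OrthAt d F h = ∀ A → ∣ A ∣ ≡ d → Annihilates F h A

  heads : ∀ {N n} → (Fin N → Subset (suc n)) → Vector ℤ N
  heads F i = χ (head (F i))

  tails : ∀ {N n} → (Fin N → Subset (suc n)) → Fin N → Subset n
  tails F i = tail (F i)

  _⊙_ : ∀ {N} → Vector ℤ N → Vector ℤ N → Vector ℤ N
  (h ⊙ g) i = h i * g i

  orthBelow-sum : ∀ {N n a} (F : Fin N → Subset n) h → OrthBelow (suc a) F h → sum h ≡ 0ℤ
  orthBelow-sum {n = n} F h orth = trans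
    (sum-cong-≗ λ i → sym (trans (cong (h i *_) (monomial-∅ (F i))) (ℤP.*-identityʳ (h i))))
    (orth ∅ (s≤s (ℕP.≤-trans (ℕP.≤-reflexive (∣⊥∣≡0 n)) z≤n)))

  orthBelow-inside : ∀ {N n a} (F : Fin N → Subset (suc n)) h →
    OrthBelow a F h → OrthBelow (pred a) (tails F) (h ⊙ heads F)
  orthBelow-inside {a = suc a} F h orth A ∣A∣<a = trans
    (sum-cong-≗ λ i → trans (ℤP.*-assoc (h i) _ _) (cong (h i *_) (sym (monomial-inside A (F i)))))
    (orth (inside ∷ A) (s≤s ∣A∣<a))

  orthBelow-outside : ∀ {N n a} (F : Fin N → Subset (suc n)) h →
    OrthBelow a F h → OrthBelow a (tails F) h
  orthBelow-outside F h orth A ∣A∣<a = trans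
    (sum-cong-≗ λ i → cong (h i *_) (sym (monomial-outside A (F i))))
    (orth (outside ∷ A) ∣A∣<a)

  private
    expand-Φ : ∀ h u v x y z t → h * (u * (v * ((x + y + z - + 2) * t))) ≡
      ((h * x) * (u * (v * t)) + h * ((u * y) * (v * t)))
      + (h * (u * ((v * z) * t)) + (- + 2) * (h * (u * (v * t))))
    expand-Φ = solve-∀

  Φ-expansion : ∀ {N n} (F : Fin N → Subset (suc n)) (h u v : Vector ℤ N) →
    let F′ = tails F ; c = heads F in
    trilinear (ΦOn F) h u v ≡
      (trilinear (ΦOn F′) (h ⊙ c) u v + trilinear (ΦOn F′) h (u ⊙ c) v)
      + (trilinear (ΦOn F′) h u (v ⊙ c) + (- + 2) * trilinear (ΦOn F′) h u v)
  Φ-expansion F h u v = begin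
    trilinear (ΦOn F) h u v
      ≡⟨ ∑³-cong (λ i j l → trans (cong (λ t → h i * (u j * (v l * t))) (Φ-head (F i) (F j) (F l)))
                                  (expand-Φ (h i) (u j) (v l) (c i) (c j) (c l) (ΦOn F′ i j l))) ⟩
    ∑³ (λ i j l → (t₁ i j l + t₂ i j l) + (t₃ i j l + (- + 2) * t₄ i j l))
      ≡⟨ ∑³-+ (λ i j l → t₁ i j l + t₂ i j l) (λ i j l → t₃ i j l + (- + 2) * t₄ i j l) ⟩
    ∑³ (λ i j l → t₁ i j l + t₂ i j l) + ∑³ (λ i j l → t₃ i j l + (- + 2) * t₄ i j l)
      ≡⟨ cong₂ _+_ (∑³-+ t₁ t₂) (trans (∑³-+ t₃ (λ i j l → (- + 2) * t₄ i j l))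
                                      (cong (_+_ (∑³ t₃)) (∑³-scale (- + 2) t₄))) ⟩
    (∑³ t₁ + ∑³ t₂) + (∑³ t₃ + (- + 2) * ∑³ t₄) ∎
    where
    open ≡-Reasoning
    F′ = tails F
    c = heads F
    t₁ t₂ t₃ t₄ : Fin _ → Fin _ → Fin _ → ℤ
    t₁ i j l = (h i * c i) * (u j * (v l * ΦOn F′ i j l))
    t₂ i j l = h i * ((u j * c j) * (v l * ΦOn F′ i j l))
    t₃ i j l = h i * (u j * ((v l * c l) * ΦOn F′ i j l))
    t₄ i j l = h i * (u j * (v l * ΦOn F′ i j l))

  budget₁ : ∀ {n} a b c → suc n < a ℕ.+ b ℕ.+ c → n < pred a ℕ.+ b ℕ.+ c
  budget₁ zero    b c lt = ℕP.<-trans (ℕP.n<1+n _) lt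
  budget₁ (suc a) b c lt = ℕP.≤-pred lt

  budget₂ : ∀ {n} a b c → suc n < a ℕ.+ b ℕ.+ c → n < a ℕ.+ pred b ℕ.+ c
  budget₂ a zero    c lt = ℕP.<-trans (ℕP.n<1+n _) lt
  budget₂ {n} a (suc b) c lt = ℕP.≤-pred (subst (suc n <_) (cong (ℕ._+ c) (ℕP.+-suc a b)) lt)

  budget₃ : ∀ {n} a b c → suc n < a ℕ.+ b ℕ.+ c → n < a ℕ.+ b ℕ.+ pred c
  budget₃ a b zero    lt = ℕP.<-trans (ℕP.n<1+n _) lt
  budget₃ {n} a b (suc c) lt = ℕP.≤-pred (subst (suc n <_) (ℕP.+-suc (a ℕ.+ b) c) lt)

  -- The slice-rank bound for Φ: Φ has degree n, so if the three arguments are orthogonal to all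
  -- monomials of degrees < a, < b, < c with n < a + b + c, every monomial of Φ is killed by one of
  -- them.
  Φ-vanishing : ∀ n {N} (F : Fin N → Subset n) a b c (h u v : Vector ℤ N) → n < a ℕ.+ b ℕ.+ c →
    OrthBelow a F h → OrthBelow b F u → OrthBelow c F v → trilinear (ΦOn F) h u v ≡ 0ℤ
  Φ-vanishing zero F a b c h u v 0<a+b+c oh ou ov = begin
    trilinear (ΦOn F) h u v
      ≡⟨ ∑³-cong (λ i j l → cong (λ t → h i * (u j * t))
                   (trans (cong (v l *_) (Φ-empty (F i) (F j) (F l))) (ℤP.*-identityʳ (v l)))) ⟩
    ∑³ (λ i j l → h i * (u j * v l))   ≡⟨ ∑³-product h u v ⟩
    sum h * (sum u * sum v)            ≡⟨ some-sum-vanishes a b c 0<a+b+c oh ou ov ⟩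
    0ℤ                                 ∎
    where
    open ≡-Reasoning
    some-sum-vanishes : ∀ a b c → 0 < a ℕ.+ b ℕ.+ c →
      OrthBelow a F h → OrthBelow b F u → OrthBelow c F v → sum h * (sum u * sum v) ≡ 0ℤ
    some-sum-vanishes (suc a) b c _ oh _ _ =
      trans (cong (_* (sum u * sum v)) (orthBelow-sum F h oh)) (ℤP.*-zeroˡ (sum u * sum v))
    some-sum-vanishes zero (suc b) c _ _ ou _ =
      trans (cong (λ t → sum h * (t * sum v)) (orthBelow-sum F u ou)) (ℤP.*-zeroʳ (sum h))
    some-sum-vanishes zero zero (suc c) _ _ _ ov =
      trans (cong (λ t → sum h * (sum u * t)) (orthBelow-sum F v ov))
            (trans (cong (sum h *_) (ℤP.*-zeroʳ (sum u))) (ℤP.*-zeroʳ (sum h)))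
  Φ-vanishing (suc n) F a b c h u v n<a+b+c oh ou ov = trans (Φ-expansion F h u v)
    (cong₂ _+_ (cong₂ _+_ first second) (cong₂ _+_ third (cong ((- + 2) *_) rest)))
    where
    first : trilinear (ΦOn (tails F)) (h ⊙ heads F) u v ≡ 0ℤ
    first = Φ-vanishing n (tails F) (pred a) b c (h ⊙ heads F) u v (budget₁ a b c n<a+b+c)
              (orthBelow-inside F h oh) (orthBelow-outside F u ou) (orthBelow-outside F v ov)
    second : trilinear (ΦOn (tails F)) h (u ⊙ heads F) v ≡ 0ℤ
    second = Φ-vanishing n (tails F) a (pred b) c h (u ⊙ heads F) v (budget₂ a b c n<a+b+c)
              (orthBelow-outside F h oh) (orthBelow-inside F u ou) (orthBelow-outside F v ov)
    third : trilinear (ΦOn (tails F)) h u (v ⊙ heads F) ≡ 0ℤ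
    third = Φ-vanishing n (tails F) a b (pred c) h u (v ⊙ heads F) (budget₃ a b c n<a+b+c)
              (orthBelow-outside F h oh) (orthBelow-outside F u ou) (orthBelow-inside F v ov)
    rest : trilinear (ΦOn (tails F)) h u v ≡ 0ℤ
    rest = Φ-vanishing n (tails F) a b c h u v (ℕP.<-trans (ℕP.n<1+n n) n<a+b+c)
              (orthBelow-outside F h oh) (orthBelow-outside F u ou) (orthBelow-outside F v ov)

  -- Uniform families: orthogonality in degree d gives orthogonality in all degrees ≤ d.

  ∑ₗ : ∀ {A : Set} → (A → ℤ) → List A → ℤ
  ∑ₗ g []       = 0ℤ
  ∑ₗ g (x ∷ xs) = g x + ∑ₗ g xs

  ∑ₗ-map : ∀ {A B : Set} (g : B → ℤ) (f : A → B) xs → ∑ₗ g (map f xs) ≡ ∑ₗ (g ∘ f) xs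
  ∑ₗ-map g f []       = refl
  ∑ₗ-map g f (x ∷ xs) = cong (_+_ (g (f x))) (∑ₗ-map g f xs)

  ∑ₗ-scale : ∀ {A : Set} c (g : A → ℤ) xs → ∑ₗ (λ x → c * g x) xs ≡ c * ∑ₗ g xs
  ∑ₗ-scale c g []       = sym (ℤP.*-zeroʳ c)
  ∑ₗ-scale c g (x ∷ xs) =
    trans (cong (_+_ (c * g x)) (∑ₗ-scale c g xs)) (sym (ℤP.*-distribˡ-+ c (g x) (∑ₗ g xs)))

  ∑ₗ-zero : ∀ {A : Set} (g : A → ℤ) {xs} → All (λ x → g x ≡ 0ℤ) xs → ∑ₗ g xs ≡ 0ℤ
  ∑ₗ-zero g []         = refl
  ∑ₗ-zero g (gx≡0 ∷ z) = cong₂ _+_ gx≡0 (∑ₗ-zero g z)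

  sum-∑ₗ-comm : ∀ {N} {A : Set} (h : Vector ℤ N) (g : A → Vector ℤ N) xs →
    sum (λ i → h i * ∑ₗ (λ x → g x i) xs) ≡ ∑ₗ (λ x → sum (λ i → h i * g x i)) xs
  sum-∑ₗ-comm h g []       = sum-zero _ (λ i → ℤP.*-zeroʳ (h i))
  sum-∑ₗ-comm h g (x ∷ xs) = begin
    sum (λ i → h i * (g x i + ∑ₗ (λ y → g y i) xs))
      ≡⟨ sum-cong-≗ (λ i → ℤP.*-distribˡ-+ (h i) (g x i) (∑ₗ (λ y → g y i) xs)) ⟩
    sum (λ i → h i * g x i + h i * ∑ₗ (λ y → g y i) xs)
      ≡⟨ ∑-distrib-+ (λ i → h i * g x i) (λ i → h i * ∑ₗ (λ y → g y i) xs) ⟩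
    sum (λ i → h i * g x i) + sum (λ i → h i * ∑ₗ (λ y → g y i) xs)
      ≡⟨ cong (_+_ (sum (λ i → h i * g x i))) (sum-∑ₗ-comm h g xs) ⟩
    sum (λ i → h i * g x i) + ∑ₗ (λ y → sum (λ i → h i * g y i)) xs ∎
    where open ≡-Reasoning

  extensions : ∀ {n} → Subset n → List (Subset n)
  extensions []            = []
  extensions (inside ∷ A)  = map (inside ∷_) (extensions A)
  extensions (outside ∷ A) = (inside ∷ A) ∷ map (outside ∷_) (extensions A)

  extensions-size : ∀ {n} (A : Subset n) → All (λ A′ → ∣ A′ ∣ ≡ suc ∣ A ∣) (extensions A)
  extensions-size []            = []
  extensions-size (inside ∷ A)  =
    map⁺ (All.map (cong suc) (extensions-size A))
  extensions-size (outside ∷ A) = refl ∷ map⁺ (extensions-size A)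

  ∣∷∣ : ∀ {n} x (X : Subset n) → + ∣ x ∷ X ∣ ≡ χ x + + ∣ X ∣
  ∣∷∣ true  X = refl
  ∣∷∣ false X = sym (ℤP.+-identityˡ _)

  private
    extend-in  : ∀ m c a → 1ℤ * (m * (c - a)) ≡ 1ℤ * m * ((1ℤ + c) - (1ℤ + a))
    extend-in  = solve-∀
    extend-out : ∀ m c a → 0ℤ * (m * (c - a)) ≡ 0ℤ * m * ((0ℤ + c) - (1ℤ + a))
    extend-out = solve-∀
    extend-new : ∀ t m c a → t * m + m * (c - a) ≡ m * ((t + c) - a)
    extend-new = solve-∀

  -- Summing the monomials one degree higher than A: each of the |X| - |A| points of X outside A
  -- contributes the monomial of A (when A ⊆ X).
  extension-identity : ∀ {n} (A X : Subset n) →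
    ∑ₗ (λ A′ → monomial A′ X) (extensions A) ≡ monomial A X * (+ ∣ X ∣ - + ∣ A ∣)
  extension-identity [] [] = refl
  extension-identity (inside ∷ A) (x ∷ X) = begin
    ∑ₗ (λ A′ → monomial A′ (x ∷ X)) (map (inside ∷_) (extensions A))
      ≡⟨ ∑ₗ-map (λ A′ → monomial A′ (x ∷ X)) (inside ∷_) (extensions A) ⟩
    ∑ₗ (λ A′ → χ x * monomial A′ X) (extensions A)
      ≡⟨ ∑ₗ-scale (χ x) (λ A′ → monomial A′ X) (extensions A) ⟩
    χ x * ∑ₗ (λ A′ → monomial A′ X) (extensions A)
      ≡⟨ cong (χ x *_) (extension-identity A X) ⟩
    χ x * (monomial A X * (+ ∣ X ∣ - + ∣ A ∣))
      ≡⟨ regroup x ⟩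
    χ x * monomial A X * (+ ∣ x ∷ X ∣ - + ∣ inside ∷ A ∣) ∎
    where
    open ≡-Reasoning
    regroup : ∀ x → χ x * (monomial A X * (+ ∣ X ∣ - + ∣ A ∣))
                      ≡ χ x * monomial A X * (+ ∣ x ∷ X ∣ - + (suc ∣ A ∣))
    regroup true  = extend-in  (monomial A X) (+ ∣ X ∣) (+ ∣ A ∣)
    regroup false = extend-out (monomial A X) (+ ∣ X ∣) (+ ∣ A ∣)
  extension-identity (outside ∷ A) (x ∷ X) = begin
    χ x * monomial A X + ∑ₗ (λ A′ → monomial A′ (x ∷ X)) (map (outside ∷_) (extensions A))
      ≡⟨ cong (_+_ (χ x * monomial A X))
              (trans (∑ₗ-map (λ A′ → monomial A′ (x ∷ X)) (outside ∷_) (extensions A))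
                     (extension-identity A X)) ⟩
    χ x * monomial A X + monomial A X * (+ ∣ X ∣ - + ∣ A ∣)
      ≡⟨ extend-new (χ x) (monomial A X) (+ ∣ X ∣) (+ ∣ A ∣) ⟩
    monomial A X * ((χ x + + ∣ X ∣) - + ∣ A ∣)
      ≡⟨ cong (λ t → monomial A X * (t - + ∣ A ∣)) (∣∷∣ x X) ⟨
    monomial A X * (+ ∣ x ∷ X ∣ - + ∣ A ∣) ∎
    where open ≡-Reasoning

  -- On a k-uniform family, orthogonality in degree a + 1 ≤ k implies orthogonality in degree a:
  -- weighting the degree-a condition by k - a ≠ 0 turns it into a sum of degree-(a+1) conditions.
  orthAt-step-down : ∀ {N n k a} (F : Fin N → Subset n) h → (∀ i → ∣ F i ∣ ≡ k) → a < k →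
    OrthAt (suc a) F h → OrthAt a F h
  orthAt-step-down {k = k} {a} F h uniform a<k orth A ∣A∣≡a
    with ℤP.i*j≡0⇒i≡0∨j≡0 (sum (λ i → h i * monomial A (F i))) weighted
    where
    weighted : sum (λ i → h i * monomial A (F i)) * (+ k - + a) ≡ 0ℤ
    weighted = begin
      sum (λ i → h i * monomial A (F i)) * (+ k - + a)
        ≡⟨ *-distribʳ-sum (+ k - + a) (λ i → h i * monomial A (F i)) ⟩
      sum (λ i → h i * monomial A (F i) * (+ k - + a))
        ≡⟨ sum-cong-≗ (λ i → trans (ℤP.*-assoc (h i) _ _) (cong (h i *_) (sym (trans
             (extension-identity A (F i))
             (cong₂ (λ s t → monomial A (F i) * (+ s - + t)) (uniform i) ∣A∣≡a))))) ⟩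
      sum (λ i → h i * ∑ₗ (λ A′ → monomial A′ (F i)) (extensions A))
        ≡⟨ sum-∑ₗ-comm h (λ A′ i → monomial A′ (F i)) (extensions A) ⟩
      ∑ₗ (λ A′ → sum (λ i → h i * monomial A′ (F i))) (extensions A)
        ≡⟨ ∑ₗ-zero _ (All.map (λ {A′} ∣A′∣ → orth A′ (trans ∣A′∣ (cong suc ∣A∣≡a)))
                                (extensions-size A)) ⟩
      0ℤ ∎
      where open ≡-Reasoning
  ... | inj₁ annihilated = annihilated
  ... | inj₂ k-a≡0 = contradiction (ℤP.+-injective (ℤP.i-j≡0⇒i≡j (+ k) (+ a) k-a≡0)) (ℕP.<⇒≢ a<k ∘ sym)

  downward-induction : ∀ (P : ℕ → Set) {d} → (∀ {a} → a < d → P (suc a) → P a) → P d →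
    ∀ {a} → a ≤ d → P a
  downward-induction P {zero}  step Pd z≤n = Pd
  downward-induction P {suc d} step Pd a≤1+d with ℕP.m≤n⇒m<n∨m≡n a≤1+d
  ... | inj₂ refl       = Pd
  ... | inj₁ (s≤s a≤d) =
    downward-induction P (λ a<d → step (ℕP.m<n⇒m<1+n a<d)) (step (ℕP.n<1+n d) Pd) a≤d

  orthAt⇒orthBelow : ∀ {N n k d} (F : Fin N → Subset n) h → (∀ i → ∣ F i ∣ ≡ k) → d ≤ k →
    OrthAt d F h → OrthBelow (suc d) F h
  orthAt⇒orthBelow F h uniform d≤k orth A ∣A∣<1+d =
    downward-induction (λ a → OrthAt a F h)
      (λ a<d → orthAt-step-down F h uniform (ℕP.<-≤-trans a<d d≤k)) orth (ℕP.≤-pred ∣A∣<1+d) A refl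

  subsetsOfSize : ∀ n → ℕ → List (Subset n)
  subsetsOfSize zero    zero    = [] ∷ []
  subsetsOfSize zero    (suc d) = []
  subsetsOfSize (suc n) zero    = map (outside ∷_) (subsetsOfSize n zero)
  subsetsOfSize (suc n) (suc d) =
    map (inside ∷_) (subsetsOfSize n d) ++ map (outside ∷_) (subsetsOfSize n (suc d))

  subsetsOfSize-length : ∀ n d → length (subsetsOfSize n d) ≡ n C d
  subsetsOfSize-length zero    zero    = refl
  subsetsOfSize-length zero    (suc d) = refl
  subsetsOfSize-length (suc n) zero    =
    trans (ListP.length-map (outside ∷_) (subsetsOfSize n zero)) (subsetsOfSize-length n zero)
  subsetsOfSize-length (suc n) (suc d) = begin
    length (map (inside ∷_) (subsetsOfSize n d) ++ map (outside ∷_) (subsetsOfSize n (suc d)))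
      ≡⟨ ListP.length-++ (map (inside ∷_) (subsetsOfSize n d)) ⟩
    length (map (inside ∷_) (subsetsOfSize n d)) ℕ.+ length (map (outside ∷_) (subsetsOfSize n (suc d)))
      ≡⟨ cong₂ ℕ._+_ (trans (ListP.length-map (inside ∷_) (subsetsOfSize n d)) (subsetsOfSize-length n d))
                     (trans (ListP.length-map (outside ∷_) (subsetsOfSize n (suc d)))
                            (subsetsOfSize-length n (suc d))) ⟩
    n C d ℕ.+ n C suc d
      ≡⟨ nCk+nC[k+1]≡[n+1]C[k+1] n d ⟩
    suc n C suc d ∎
    where open ≡-Reasoning

  subsetsOfSize-complete : ∀ {n d} (A : Subset n) → ∣ A ∣ ≡ d → A ∈ₗ subsetsOfSize n d
  subsetsOfSize-complete {zero}  {zero}  []            _     = here refl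
  subsetsOfSize-complete {suc n} {zero}  (outside ∷ A) ∣A∣≡0 =
    ∈-map⁺ (outside ∷_) (subsetsOfSize-complete A ∣A∣≡0)
  subsetsOfSize-complete {suc n} {suc d} (inside ∷ A)  ∣A∣≡d =
    ∈-++⁺ˡ (∈-map⁺ (inside ∷_) (subsetsOfSize-complete A (ℕP.suc-injective ∣A∣≡d)))
  subsetsOfSize-complete {suc n} {suc d} (outside ∷ A) ∣A∣≡d =
    ∈-++⁺ʳ (map (inside ∷_) (subsetsOfSize n d)) (∈-map⁺ (outside ∷_) (subsetsOfSize-complete A ∣A∣≡d))

  monomialsOn : ∀ {N n} → (Fin N → Subset n) → ℕ → List (Vector ℤ N)
  monomialsOn {n = n} F d = map (λ A i → monomial A (F i)) (subsetsOfSize n d)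

  orthogonal-to-monomials : ∀ {N n d} (F : Fin N → Subset n) h →
    All (Orthogonal h) (monomialsOn F d) → OrthAt d F h
  orthogonal-to-monomials F h orth A ∣A∣≡d = All.lookup (map⁻ orth) (subsetsOfSize-complete A ∣A∣≡d)

  uniform-Φ-vanishing : ∀ {N n k d} (F : Fin N → Subset n) → (∀ i → ∣ F i ∣ ≡ k) → d ≤ k →
    n < suc d ℕ.+ suc d ℕ.+ suc d → ∀ h u v →
    All (Orthogonal h) (monomialsOn F d) → All (Orthogonal u) (monomialsOn F d) →
    All (Orthogonal v) (monomialsOn F d) → trilinear (ΦOn F) h u v ≡ 0ℤ
  uniform-Φ-vanishing {n = n} {d = d} F uniform d≤k n<3[d+1] h u v oh ou ov =
    Φ-vanishing n F (suc d) (suc d) (suc d) h u v n<3[d+1] (lift h oh) (lift u ou) (lift v ov)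
    where
    lift : ∀ g → All (Orthogonal g) (monomialsOn F d) → OrthBelow (suc d) F g
    lift g og = orthAt⇒orthBelow F g uniform d≤k (orthogonal-to-monomials F g og)

  -- Φ is diagonal on a uniform sunflower-free family.

  PetalEquations : ∀ {n} → Subset n → Subset n → Subset n → Set
  PetalEquations X Y Z = (X ∩ Y ≡ X ∩ Y ∩ Z) × (X ∩ Z ≡ X ∩ Y ∩ Z) × (Y ∩ Z ≡ X ∩ Y ∩ Z)

  -- A nonzero factor xₓ + yₓ + zₓ - 2 means the point lies in none, one or all three sets.
  petal-coordinate : ∀ x y z → χ x + χ y + χ z - + 2 ≢ 0ℤ →
    (x ∧ y ≡ x ∧ y ∧ z) × (x ∧ z ≡ x ∧ y ∧ z) × (y ∧ z ≡ x ∧ y ∧ z)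
  petal-coordinate true  true  true  _  = refl , refl , refl
  petal-coordinate true  true  false nz = contradiction refl nz
  petal-coordinate true  false true  nz = contradiction refl nz
  petal-coordinate true  false false _  = refl , refl , refl
  petal-coordinate false true  true  nz = contradiction refl nz
  petal-coordinate false true  false _  = refl , refl , refl
  petal-coordinate false false true  _  = refl , refl , refl
  petal-coordinate false false false _  = refl , refl , refl

  Φ-nonzero⇒petals : ∀ {n} (X Y Z : Subset n) → Φ X Y Z ≢ 0ℤ → PetalEquations X Y Z
  Φ-nonzero⇒petals [] [] [] _ = refl , refl , refl
  Φ-nonzero⇒petals (x ∷ X) (y ∷ Y) (z ∷ Z) nz
    with petal-coordinate x y z (nonzero-factorˡ _ (Φ X Y Z) nz)
       | Φ-nonzero⇒petals X Y Z (nonzero-factorʳ (χ x + χ y + χ z - + 2) _ nz)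
  ... | e₁ , e₂ , e₃ | E₁ , E₂ , E₃ = cong₂ _∷_ e₁ E₁ , cong₂ _∷_ e₂ E₂ , cong₂ _∷_ e₃ E₃

  -- On the diagonal every factor of Φ is 1 or -2.
  Φ-diagonal-nonzero : ∀ {n} (X : Subset n) → Φ X X X ≢ 0ℤ
  Φ-diagonal-nonzero []           = λ ()
  Φ-diagonal-nonzero (inside ∷ X)  =
    nonzero-product {χ true + χ true + χ true - + 2} (λ ()) (Φ-diagonal-nonzero X)
  Φ-diagonal-nonzero (outside ∷ X) =
    nonzero-product {χ false + χ false + χ false - + 2} (λ ()) (Φ-diagonal-nonzero X)

  ⊆-via-∩ : ∀ {n} {P Q R : Subset n} → P ∩ P ≡ Q → Q ⊆ R → P ⊆ R
  ⊆-via-∩ P∩P≡Q Q⊆R x∈P = Q⊆R (subst (_ ∈_) P∩P≡Q (x∈p∩q⁺ (x∈P , x∈P)))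

  ⊆-same-size : ∀ {n} {p q : Subset n} → p ⊆ q → ∣ q ∣ ≤ ∣ p ∣ → p ≡ q
  ⊆-same-size {p = []}          {[]}          _   _   = refl
  ⊆-same-size {p = inside ∷ p}  {inside ∷ q}  p⊆q q≤p =
    cong (inside ∷_) (⊆-same-size (drop-∷-⊆ p⊆q) (ℕP.≤-pred q≤p))
  ⊆-same-size {p = inside ∷ p}  {outside ∷ q} p⊆q _   = contradiction (p⊆q here) λ ()
  ⊆-same-size {p = outside ∷ p} {inside ∷ q}  p⊆q q<p =
    contradiction (ℕP.<-≤-trans q<p (p⊆q⇒∣p∣≤∣q∣ (drop-∷-⊆ p⊆q))) (ℕP.n≮n _)
  ⊆-same-size {p = outside ∷ p} {outside ∷ q} p⊆q q≤p =
    cong (outside ∷_) (⊆-same-size (drop-∷-⊆ p⊆q) q≤p)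

  _≟ˢ_ : ∀ {n} (X Y : Subset n) → Dec (X ≡ Y)
  _≟ˢ_ = ≡-dec BoolP._≟_

  same-size⇒≤ : ∀ {a b k} → a ≡ k → b ≡ k → a ≤ b
  same-size⇒≤ a≡k b≡k = ℕP.≤-reflexive (trans a≡k (sym b≡k))

  -- Three sets of equal size with Φ ≠ 0 either form a sunflower or coincide: if two of them agree,
  -- a petal equation puts that set inside the third, which then has to be equal to it.
  Φ-nonzero⇒equal : ∀ {n k} {X Y Z : Subset n} → ∣ X ∣ ≡ k → ∣ Y ∣ ≡ k → ∣ Z ∣ ≡ k →
    ¬ IsSunflower3 X Y Z → Φ X Y Z ≢ 0ℤ → X ≡ Y × Y ≡ Z
  Φ-nonzero⇒equal {X = X} {Y} {Z} ∣X∣ ∣Y∣ ∣Z∣ not-sunflower nz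
    with Φ-nonzero⇒petals X Y Z nz | X ≟ˢ Y | Y ≟ˢ Z | X ≟ˢ Z
  ... | _ | yes X≡Y | yes Y≡Z | _ = X≡Y , Y≡Z
  ... | e₁ , _ , _ | yes refl | no X≢Z | _ =
    contradiction (⊆-same-size (⊆-via-∩ e₁ (λ x∈ → p∩q⊆q _ _ (p∩q⊆q _ _ x∈))) (same-size⇒≤ ∣Z∣ ∣X∣)) X≢Z
  ... | _ , _ , e₃ | no X≢Y | yes refl | _ =
    contradiction (sym (⊆-same-size (⊆-via-∩ e₃ (p∩q⊆p _ _)) (same-size⇒≤ ∣X∣ ∣Y∣))) X≢Y
  ... | _ , e₂ , _ | no X≢Y | no _ | yes refl =
    contradiction (⊆-same-size (⊆-via-∩ e₂ (λ x∈ → p∩q⊆p _ _ (p∩q⊆q _ _ x∈))) (same-size⇒≤ ∣Y∣ ∣X∣)) X≢Y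
  ... | petals | no X≢Y | no Y≢Z | no X≢Z = contradiction (X≢Y , X≢Z , Y≢Z , petals) not-sunflower

  -- A k-uniform sunflower-free family of N distinct sets in dimension n < 3(d + 1), d ≤ k, has
  -- N ≤ 3·C(n, d): Φ is diagonal on it, and its trilinear form vanishes off the degree-d monomials.
  sunflower-free-bound : ∀ {N n k d} (F : Fin N → Subset n) → (∀ i → ∣ F i ∣ ≡ k) →
    (∀ {i j} → F i ≡ F j → i ≡ j) → (∀ i j l → ¬ IsSunflower3 (F i) (F j) (F l)) →
    d ≤ k → n < suc d ℕ.+ suc d ℕ.+ suc d → N ≤ n C d ℕ.+ n C d ℕ.+ n C d
  sunflower-free-bound {N} {n} {d = d} F uniform injective sunflower-free d≤k n<3[d+1] =
    subst (λ r → N ≤ r ℕ.+ r ℕ.+ r)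
      (trans (ListP.length-map (λ A i → monomial A (F i)) (subsetsOfSize n d)) (subsetsOfSize-length n d))
      (diagonal-bound (ΦOn F) W W W diagonal (λ i → Φ-diagonal-nonzero (F i))
                      (uniform-Φ-vanishing F uniform d≤k n<3[d+1]))
    where
    W = monomialsOn F d
    diagonal : ∀ i j l → ΦOn F i j l ≢ 0ℤ → i ≡ j × j ≡ l
    diagonal i j l nz with Φ-nonzero⇒equal (uniform i) (uniform j) (uniform l) (sunflower-free i j l) nz
    ... | Fi≡Fj , Fj≡Fl = injective Fi≡Fj , injective Fj≡Fl

  lookup-injective : ∀ {A : Set} {xs : List A} → Unique xs →
    ∀ {i j} → lookup xs i ≡ lookup xs j → i ≡ j
  lookup-injective {xs = x ∷ xs} (x∉xs ∷ distinct) {zero}  {zero}  _ = refl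
  lookup-injective {xs = x ∷ xs} (x∉xs ∷ distinct) {zero}  {suc j} e =
    contradiction e (All.lookup x∉xs (∈-lookup j))
  lookup-injective {xs = x ∷ xs} (x∉xs ∷ distinct) {suc i} {zero}  e =
    contradiction (sym e) (All.lookup x∉xs (∈-lookup i))
  lookup-injective {xs = x ∷ xs} (x∉xs ∷ distinct) {suc i} {suc j} e =
    cong suc (lookup-injective distinct e)

open SliceRank using (sunflower-free-bound; lookup-injective)

open import Defs
open import Data.Nat using (ℕ; suc; _+_; _*_; _≤_; _<_; _/_)
open import Data.Nat.Properties using (≤-trans; ≤-reflexive; *-comm; +-monoˡ-<; <-≤-trans)
open import Data.Nat.DivMod using (/-monoˡ-≤; m*n/n≡m; m%n<n; m≡m%n+[m/n]*n)
open import Data.Nat.Tactic.RingSolver using (solve-∀)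
open import Data.Nat.Combinatorics using (_C_)
open import Data.Fin.Subset using (Subset; ∣_∣)
open import Data.List using (List; length; lookup)
open import Data.List.Relation.Unary.All as All using (All)
open import Data.List.Relation.Unary.Unique.Propositional using (Unique)
open import Data.List.Membership.Propositional.Properties using (∈-lookup)
open import Relation.Binary.PropositionalEquality using (_≡_; cong; trans; subst; sym)

n/3≤k : ∀ {n k} → n ≤ 3 * k → n / 3 ≤ k
n/3≤k {n} {k} n≤3k =
  ≤-trans (/-monoˡ-≤ 3 n≤3k) (≤-reflexive (trans (cong (_/ 3) (*-comm 3 k)) (m*n/n≡m k 3)))

n<3[1+n/3] : ∀ n → n < suc (n / 3) + suc (n / 3) + suc (n / 3)
n<3[1+n/3] n =
  <-≤-trans (subst (_< 3 + n / 3 * 3) (sym (m≡m%n+[m/n]*n n 3)) (+-monoˡ-< (n / 3 * 3) (m%n<n n 3)))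
            (≤-reflexive (rearrange (n / 3)))
  where
  rearrange : ∀ d → 3 + d * 3 ≡ suc d + suc d + suc d
  rearrange = solve-∀

-- The family, indexed by list positions, satisfies the hypotheses of sunflower-free-bound with
-- d = ⌊n/3⌋.
theorem5 : (k n : ℕ) → 3 * k ≤ 2 * n → n ≤ 3 * k →
    (𝓕 : List (Subset n)) → Unique 𝓕 →
    All (λ F → ∣ F ∣ ≡ k) 𝓕 → NoSunflower3 𝓕 →
    length 𝓕 ≤ 3 * (n C (n / 3))
theorem5 k n _ n≤3k 𝓕 distinct sizes no-sunflower =
  ≤-trans (sunflower-free-bound (lookup 𝓕) (λ i → All.lookup sizes (∈-lookup i))
             (lookup-injective distinct)
             (λ i j l → no-sunflower _ _ _ (∈-lookup i) (∈-lookup j) (∈-lookup l))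
             (n/3≤k n≤3k) (n<3[1+n/3] n))
          (≤-reflexive (three-copies (n C (n / 3))))
  where
  three-copies : ∀ r → r + r + r ≡ 3 * r
  three-copies = solve-∀
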